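{- Let $G$ and $H$ be connected graphs of orders $n\geq 3$ and $m\geq 3$, respectively, and let $G\circ H$ be their corona product. Then $$\max\{\Delta(G)+m,\ \Delta(H)+1\}\leq \chi'_D(G\circ H)\leq \max\{\chi'_D(G),\chi'_D(H)\}+m.$$
   Context: All graphs are finite and simple; $\Delta$ denotes maximum degree. The corona product $G\circ H$ is obtained by taking one copy of $G$ and $|V(G)|$ disjoint copies of $H$, and joining the $i$-th vertex of $G$ to every vertex of the $i$-th copy of $H$. A proper edge labeling assigns labels to edges so that edges sharing an endpoint get different labels. An automorphism $f$ preserves an edge labeling $c$ if $c(\{f(u),f(v)\})=c(\{u,v\})$ for every edge. The distinguishing chromatic index $\chi'_D(G)$ is the least number $d$ such that $G$ has a proper edge labeling with $d$ labels preserved only by the identity automorphism. -}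

module Defs where

open import Data.Bool using (Bool; true; false; _∧_; if_then_else_)
open import Data.Bool.Properties using (∧-comm; ∧-zeroʳ)
open import Data.Nat using (ℕ; zero; suc; _+_; _*_; _⊔_; _≤_)
open import Data.Fin using (Fin; splitAt; remQuot)
open import Data.Fin.Properties using (_≟_)
open import Data.List using (List; map; foldr; allFin)
open import Data.Nat.ListAction using (sum)
open import Data.Product using (Σ; _×_; _,_; proj₁; proj₂)
open import Data.Sum using (_⊎_; inj₁; inj₂)
open import Relation.Nullary using (¬_; yes; no; does)
open import Relation.Binary.PropositionalEquality using (_≡_; refl; _≢_)

record Graph (n : ℕ) : Set where
  field
    Adj    : Fin n → Fin n → Bool
    adj-sym : ∀ u v → Adj u v ≡ Adj v u
    adj-irrefl : ∀ v → Adj v v ≡ false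
open Graph public

data Reachable {n : ℕ} (G : Graph n) : Fin n → Fin n → Set where
  here : ∀ {v} → Reachable G v v
  step : ∀ {u w v} → Adj G u w ≡ true → Reachable G w v → Reachable G u v

Connected : ∀ {n} → Graph n → Set
Connected G = ∀ u v → Reachable G u v

degree : ∀ {n} → Graph n → Fin n → ℕ
degree {n} G v = sum (map (λ w → if Adj G v w then 1 else 0) (allFin n))

Δ : ∀ {n} → Graph n → ℕ
Δ {n} G = foldr _⊔_ 0 (map (degree G) (allFin n))

-- Corona product G ∘ H on Fin (n + n * m):
-- vertices inj₁ i are the copy of G; vertex inj₂ p with
-- remQuot m p = (i , a) is vertex a of the i-th copy of H.

eqb : ∀ {k} → Fin k → Fin k → Bool
eqb i j = does (i ≟ j)

eqb-sym : ∀ {k} (i j : Fin k) → eqb i j ≡ eqb j i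
eqb-sym i j with i ≟ j | j ≟ i
... | yes _ | yes _ = refl
... | no _  | no _  = refl
... | yes refl | no ¬p = Data.Empty.⊥-elim (¬p refl)
  where import Data.Empty
... | no ¬p | yes refl = Data.Empty.⊥-elim (¬p refl)
  where import Data.Empty

eqb-refl : ∀ {k} (i : Fin k) → eqb i i ≡ true
eqb-refl i with i ≟ i
... | yes _ = refl
... | no ¬p = Data.Empty.⊥-elim (¬p refl)
  where import Data.Empty

copy : ∀ {n} m → Fin (n * m) → Fin n
copy {n} m p = proj₁ (remQuot {n} m p)

pos : ∀ {n} m → Fin (n * m) → Fin m
pos {n} m p = proj₂ (remQuot {n} m p)

coronaAdj : ∀ {n m} → Graph n → Graph m →
            Fin (n + n * m) → Fin (n + n * m) → Bool
coronaAdj {n} {m} G H x y with splitAt n x | splitAt n y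
... | inj₁ i | inj₁ j = Adj G i j
... | inj₁ i | inj₂ q = eqb i (copy {n} m q)
... | inj₂ p | inj₁ j = eqb (copy {n} m p) j
... | inj₂ p | inj₂ q =
  eqb (copy {n} m p) (copy {n} m q)
  ∧ Adj H (pos {n} m p) (pos {n} m q)

coronaSym : ∀ {n m} (G : Graph n) (H : Graph m) x y →
            coronaAdj G H x y ≡ coronaAdj G H y x
coronaSym {n} {m} G H x y with splitAt n x | splitAt n y
... | inj₁ i | inj₁ j = adj-sym G i j
... | inj₁ i | inj₂ q = eqb-sym i (copy {n} m q)
... | inj₂ p | inj₁ j = eqb-sym (copy {n} m p) j
... | inj₂ p | inj₂ q
  rewrite eqb-sym (copy {n} m p) (copy {n} m q)
        | adj-sym H (pos {n} m p) (pos {n} m q) = refl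

coronaIrrefl : ∀ {n m} (G : Graph n) (H : Graph m) x →
               coronaAdj G H x x ≡ false
coronaIrrefl {n} {m} G H x with splitAt n x
... | inj₁ i = adj-irrefl G i
... | inj₂ p rewrite adj-irrefl H (pos {n} m p) = ∧-zeroʳ (eqb (copy {n} m p) (copy {n} m p))

corona : ∀ {n m} → Graph n → Graph m → Graph (n + n * m)
corona G H = record
  { Adj = coronaAdj G H ; adj-sym = coronaSym G H ; adj-irrefl = coronaIrrefl G H }

record Automorphism {n : ℕ} (G : Graph n) : Set where
  field
    to       : Fin n → Fin n
    from     : Fin n → Fin n
    to-from  : ∀ v → to (from v) ≡ v
    from-to  : ∀ v → from (to v) ≡ v
    preserve : ∀ u v → Adj G (to u) (to v) ≡ Adj G u v
open Automorphism public

-- An edge labeling with d labels: a label for every ordered pair, of which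
-- only the values on edges matter; it must be symmetric on edges (so it
-- is a labeling of the unordered edges {u,v}).
EdgeLabeling : ℕ → ℕ → Set
EdgeLabeling n d = Fin n → Fin n → Fin d

record IsProperEdgeLabeling {n d : ℕ} (G : Graph n) (c : EdgeLabeling n d) : Set where
  field
    symmetric : ∀ u v → Adj G u v ≡ true → c u v ≡ c v u
    proper    : ∀ u v w → Adj G u v ≡ true → Adj G u w ≡ true → v ≢ w →
                c u v ≢ c u w

Preserves : ∀ {n d} {G : Graph n} → Automorphism G → EdgeLabeling n d → Set
Preserves {G = G} f c =
  ∀ u v → Adj G u v ≡ true → c (to f u) (to f v) ≡ c u v

IsDistinguishing : ∀ {n d} (G : Graph n) → EdgeLabeling n d → Set
IsDistinguishing G c =
  ∀ (f : Automorphism G) → Preserves f c → ∀ v → to f v ≡ v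

HasDistProperLabeling : ∀ {n} → Graph n → ℕ → Set
HasDistProperLabeling {n} G d =
  Σ (EdgeLabeling n d) λ c → IsProperEdgeLabeling G c × IsDistinguishing G c

IsDistChromaticIndex : ∀ {n} → Graph n → ℕ → Set
IsDistChromaticIndex G d =
  HasDistProperLabeling G d × (∀ d′ → HasDistProperLabeling G d′ → d ≤ d′)

module Submission where

-- The edges at a vertex carry pairwise distinct labels under a
-- proper labeling, so a vertex with k neighbours forces k labels.  In G ∘ H
-- vertex i of G has degree_G(i) + m neighbours and vertex a of a copy of H
-- has degree_H(a) + 1; maximising over the vertices gives the lower bound.
--
-- From a proper distinguishing labeling c_G of G (d_G labels)
-- and a proper labeling c_H of H (d_H labels) we label G ∘ H with D + m
-- labels, D = max(d_G, d_H): edges of G keep c_G, edges of each copy of H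
-- keep c_H, and the spoke from i to vertex a of its copy gets the new label
-- D + a.  It is proper, and distinguishing as soon as m ≥ 2: a preserving
-- automorphism maps G to G (a vertex of G sees two different new labels, a
-- vertex of a copy of H only one), so it restricts to a c_G-preserving
-- automorphism of G and fixes G pointwise; it then fixes each copy of H,
-- since vertex a of copy i is the only neighbour of i along label D + a.
-- Minimality of χ'_D(G ∘ H) then gives the upper bound.

open import Defs
open import Data.Bool using (Bool; true; false; _∧_; if_then_else_)
open import Data.Bool.Properties using () renaming (_≟_ to _≟ᵇ_)
open import Data.Nat using (ℕ; suc; _+_; _*_; _⊔_; _≤_; s≤s)
open import Data.Nat.Properties using (≤-trans; m≤n+m; m≤m⊔n; m≤n⊔m; ⊔-lub; +-distribʳ-⊔; +-comm)
open import Data.Nat.ListAction using (sum)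
open import Data.Fin using (Fin; _↑ˡ_; _↑ʳ_; splitAt; join; combine; remQuot; inject≤)
  renaming (zero to fzero; suc to fsuc)
open import Data.Fin.Properties using (_≟_; splitAt-↑ˡ; splitAt-↑ʳ; join-splitAt; remQuot-combine; combine-remQuot;
  ↑ˡ-injective; ↑ʳ-injective; inject≤-injective; injective⇒≤)
open import Data.List using (List; []; _∷_; map; _++_; length; allFin; foldr; filter; lookup)
open import Data.List.Properties using (length-map; length-++; length-tabulate)
open import Data.List.Membership.Propositional.Properties using (∈-lookup)
open import Data.List.Relation.Unary.All as All using (All; []; _∷_)
import Data.List.Relation.Unary.All.Properties as All
open import Data.List.Relation.Unary.AllPairs as AllPairs using (AllPairs; []; _∷_)
import Data.List.Relation.Unary.AllPairs.Properties as AllPairs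
open import Data.List.Relation.Unary.Unique.Propositional.Properties using (allFin⁺)
open import Data.Product using (Σ; _×_; _,_; proj₁; proj₂)
open import Data.Sum using (inj₁; inj₂)
open import Data.Empty using (⊥-elim)
open import Function using (_∘_)
open import Relation.Nullary using (yes)
open import Relation.Binary.PropositionalEquality

select : ∀ {A : Set} → (A → Bool) → List A → List A
select p = filter (λ x → p x ≟ᵇ true)

sum-indicator≡length-select : ∀ {A : Set} (p : A → Bool) (xs : List A) →
  sum (map (λ x → if p x then 1 else 0) xs) ≡ length (select p xs)
sum-indicator≡length-select p [] = refl
sum-indicator≡length-select p (x ∷ xs) with p x
... | true  = cong suc (sum-indicator≡length-select p xs)
... | false = sum-indicator≡length-select p xs

map-distinct : ∀ {A B : Set} {f : A → B} → (∀ {x y} → f x ≡ f y → x ≡ y) →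
  ∀ {xs} → AllPairs _≢_ xs → AllPairs _≢_ (map f xs)
map-distinct f-inj xs! = AllPairs.map⁺ (AllPairs.map (λ x≢y → x≢y ∘ f-inj) xs!)

lookup-injective : ∀ {A : Set} (xs : List A) → AllPairs _≢_ xs →
  ∀ i j → lookup xs i ≡ lookup xs j → i ≡ j
lookup-injective (x ∷ xs) _ fzero fzero _ = refl
lookup-injective (x ∷ xs) (x∉xs ∷ _) fzero (fsuc j) e = ⊥-elim (All.lookup x∉xs (∈-lookup {xs = xs} j) e)
lookup-injective (x ∷ xs) (x∉xs ∷ _) (fsuc i) fzero e = ⊥-elim (All.lookup x∉xs (∈-lookup {xs = xs} i) (sym e))
lookup-injective (x ∷ xs) (_ ∷ xs!) (fsuc i) (fsuc j) e = cong fsuc (lookup-injective xs xs! i j e)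

distinct-length-≤ : ∀ {d} (xs : List (Fin d)) → AllPairs _≢_ xs → length xs ≤ d
distinct-length-≤ xs xs! = injective⇒≤ (λ {i} {j} → lookup-injective xs xs! i j)

-- If f x + k ≤ d for every x, the maximum of f over a list obeys the same
-- bound (k ≤ d covers the empty maximum 0).
max+k-bound : ∀ {A : Set} (f : A → ℕ) {k d} (xs : List A) →
  (∀ x → f x + k ≤ d) → k ≤ d → foldr _⊔_ 0 (map f xs) + k ≤ d
max+k-bound f []       bound k≤d = k≤d
max+k-bound f (x ∷ xs) bound k≤d =
  subst (_≤ _) (sym (+-distribʳ-⊔ _ (f x) (foldr _⊔_ 0 (map f xs))))
    (⊔-lub (bound x) (max+k-bound f xs bound k≤d))

eqb⇒≡ : ∀ {k} {i j : Fin k} → eqb i j ≡ true → i ≡ j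
eqb⇒≡ {i = i} {j} e with i ≟ j | e
... | yes i≡j | _ = i≡j

∧-true : ∀ {x y : Bool} → x ∧ y ≡ true → x ≡ true × y ≡ true
∧-true {true} y≡true = refl , y≡true

neighbours : ∀ {n} → Graph n → Fin n → List (Fin n)
neighbours {n} G v = select (Adj G v) (allFin n)

degree≡#neighbours : ∀ {n} (G : Graph n) v → degree G v ≡ length (neighbours G v)
degree≡#neighbours {n} G v = sum-indicator≡length-select (Adj G v) (allFin n)

neighbours-adjacent : ∀ {n} (G : Graph n) v → All (λ w → Adj G v w ≡ true) (neighbours G v)
neighbours-adjacent {n} G v = All.all-filter (λ w → Adj G v w ≟ᵇ true) (allFin n)

neighbours-distinct : ∀ {n} (G : Graph n) v → AllPairs _≢_ (neighbours G v)
neighbours-distinct {n} G v = AllPairs.filter⁺ (λ w → Adj G v w ≟ᵇ true) (allFin⁺ n)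

-- If every vertex v satisfies degree v + k ≤ d, then so does the maximum
-- degree (the vertex v₀ only witnesses k ≤ d).
Δ+k-bound : ∀ {n} (G : Graph n) {k d} → (∀ v → degree G v + k ≤ d) → Fin n → Δ G + k ≤ d
Δ+k-bound {n} G {k} bound v₀ =
  max+k-bound (degree G) (allFin n) bound (≤-trans (m≤n+m k (degree G v₀)) (bound v₀))

module ProperLabeling {N d} (K : Graph N) (c : EdgeLabeling N d) (c-proper : IsProperEdgeLabeling K c) where
  open IsProperEdgeLabeling c-proper

  labels-distinct : ∀ x ys → All (λ y → Adj K x y ≡ true) ys → AllPairs _≢_ ys →
    AllPairs _≢_ (map (c x) ys)
  labels-distinct x [] _ _ = []
  labels-distinct x (y ∷ ys) (xy ∷ xys) (y∉ys ∷ ys!) =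
    All.map⁺ (All.zipWith (λ (xz , y≢z) → proper x y _ xy xz y≢z) (xys , y∉ys))
    ∷ labels-distinct x ys xys ys!

  #neighbours≤#labels : ∀ x ys → All (λ y → Adj K x y ≡ true) ys → AllPairs _≢_ ys → length ys ≤ d
  #neighbours≤#labels x ys xys ys! =
    subst (_≤ d) (length-map (c x) ys) (distinct-length-≤ _ (labels-distinct x ys xys ys!))

inverse : ∀ {N} {K : Graph N} → Automorphism K → Automorphism K
inverse {K = K} f = record
  { to = from f ; from = to f ; to-from = from-to f ; from-to = to-from f
  ; preserve = λ u v → begin
      Adj K (from f u) (from f v)                  ≡⟨ preserve f (from f u) (from f v) ⟨
      Adj K (to f (from f u)) (to f (from f v))    ≡⟨ cong₂ (Adj K) (to-from f u) (to-from f v) ⟩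
      Adj K u v                                    ∎ }
  where open ≡-Reasoning

inverse-preserves : ∀ {N d} {K : Graph N} {c : EdgeLabeling N d} (f : Automorphism K) →
  Preserves f c → Preserves (inverse f) c
inverse-preserves {K = K} {c} f f-pres u v uv = begin
  c (from f u) (from f v)                ≡⟨ f-pres (from f u) (from f v) adj ⟨
  c (to f (from f u)) (to f (from f v))  ≡⟨ cong₂ c (to-from f u) (to-from f v) ⟩
  c u v                                  ∎
  where
  open ≡-Reasoning
  adj : Adj K (from f u) (from f v) ≡ true
  adj = trans (preserve (inverse f) u v) uv

module Corona {n m : ℕ} (G : Graph n) (H : Graph m) where
  GH : Graph (n + n * m)
  GH = corona G H

  gV : Fin n → Fin (n + n * m)
  gV i = i ↑ˡ (n * m)

  hV : Fin n → Fin m → Fin (n + n * m)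
  hV i a = n ↑ʳ combine i a

  split-gV : ∀ i → splitAt n (gV i) ≡ inj₁ i
  split-gV i = splitAt-↑ˡ n i (n * m)

  split-hV : ∀ i a → splitAt n (hV i a) ≡ inj₂ (combine i a)
  split-hV i a = splitAt-↑ʳ n (n * m) (combine i a)

  copy-hV : ∀ i a → copy {n} m (combine i a) ≡ i
  copy-hV i a = cong proj₁ (remQuot-combine {n} {m} i a)

  pos-hV : ∀ i a → pos {n} m (combine i a) ≡ a
  pos-hV i a = cong proj₂ (remQuot-combine {n} {m} i a)

  data View : Fin (n + n * m) → Set where
    inG : ∀ i → View (gV i)
    inH : ∀ i a → View (hV i a)

  view : ∀ x → View x
  view x with splitAt n x in eq
  ... | inj₁ i = subst View x≡ (inG i)
    where
    x≡ : gV i ≡ x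
    x≡ = trans (cong (join n (n * m)) (sym eq)) (join-splitAt n (n * m) x)
  ... | inj₂ q = subst View x≡ (inH (copy {n} m q) (pos {n} m q))
    where
    x≡ : hV (copy {n} m q) (pos {n} m q) ≡ x
    x≡ = trans (cong (n ↑ʳ_) (combine-remQuot {n} m q))
               (trans (cong (join n (n * m)) (sym eq)) (join-splitAt n (n * m) x))

  gV-injective : ∀ {i j} → gV i ≡ gV j → i ≡ j
  gV-injective = ↑ˡ-injective (n * m) _ _

  hV-injective : ∀ {i j a b} → hV i a ≡ hV j b → i ≡ j × a ≡ b
  hV-injective {i} {j} {a} {b} e = cong proj₁ same , cong proj₂ same
    where
    same : (i , a) ≡ (j , b)
    same = trans (sym (remQuot-combine {n} {m} i a))
             (trans (cong (remQuot {n} m) (↑ʳ-injective n _ _ e)) (remQuot-combine {n} {m} j b))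

  gV≢hV : ∀ j i a → gV j ≢ hV i a
  gV≢hV j i a e with trans (sym (split-gV j)) (trans (cong (splitAt n) e) (split-hV i a))
  ... | ()

  adj-gg : ∀ i j → Adj GH (gV i) (gV j) ≡ Adj G i j
  adj-gg i j rewrite split-gV i | split-gV j = refl

  adj-gh : ∀ i j a → Adj GH (gV i) (hV j a) ≡ eqb i j
  adj-gh i j a rewrite split-gV i | split-hV j a | copy-hV j a = refl

  adj-hg : ∀ i a j → Adj GH (hV i a) (gV j) ≡ eqb i j
  adj-hg i a j rewrite split-hV i a | split-gV j | copy-hV i a = refl

  adj-hh : ∀ i a j b → Adj GH (hV i a) (hV j b) ≡ eqb i j ∧ Adj H a b
  adj-hh i a j b rewrite split-hV i a | split-hV j b | copy-hV i a | copy-hV j b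
                       | pos-hV i a | pos-hV j b = refl

  spoke : ∀ i a → Adj GH (gV i) (hV i a) ≡ true
  spoke i a = trans (adj-gh i i a) (eqb-refl i)

  spoke′ : ∀ i a → Adj GH (hV i a) (gV i) ≡ true
  spoke′ i a = trans (adj-hg i a i) (eqb-refl i)

  spoke-same : ∀ {i j a} → Adj GH (gV i) (hV j a) ≡ true → i ≡ j
  spoke-same {i} {j} {a} e = eqb⇒≡ (trans (sym (adj-gh i j a)) e)

  spoke′-same : ∀ {i a j} → Adj GH (hV i a) (gV j) ≡ true → i ≡ j
  spoke′-same {i} {a} {j} e = eqb⇒≡ (trans (sym (adj-hg i a j)) e)

  hh-edge : ∀ {i a j b} → Adj GH (hV i a) (hV j b) ≡ true → i ≡ j × Adj H a b ≡ true
  hh-edge {i} {a} {j} {b} e with ∧-true (trans (sym (adj-hh i a j b)) e)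
  ... | ij , ab = eqb⇒≡ ij , ab

  hh-edge-within : ∀ i {a b} → Adj H a b ≡ true → Adj GH (hV i a) (hV i b) ≡ true
  hh-edge-within i {a} {b} ab = trans (adj-hh i a i b) (trans (cong (_∧ Adj H a b) (eqb-refl i)) ab)

module LowerBound {n m d : ℕ} (G : Graph n) (H : Graph m)
                  (c : EdgeLabeling (n + n * m) d) (c-proper : IsProperEdgeLabeling (corona G H) c) where
  open Corona G H
  open ProperLabeling GH c c-proper

  gV-bound : ∀ i → degree G i + m ≤ d
  gV-bound i = subst (_≤ d) #nbrs (#neighbours≤#labels (gV i) nbrs nbrs-adjacent nbrs-distinct)
    where
    nbrs : List (Fin (n + n * m))
    nbrs = map gV (neighbours G i) ++ map (hV i) (allFin m)

    nbrs-adjacent : All (λ y → Adj GH (gV i) y ≡ true) nbrs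
    nbrs-adjacent = All.++⁺
      (All.map⁺ (All.map (λ {j} ij → trans (adj-gg i j) ij) (neighbours-adjacent G i)))
      (All.map⁺ (All.universal (spoke i) (allFin m)))

    nbrs-distinct : AllPairs _≢_ nbrs
    nbrs-distinct = AllPairs.++⁺
      (map-distinct gV-injective (neighbours-distinct G i))
      (map-distinct (proj₂ ∘ hV-injective) (allFin⁺ m))
      (All.map⁺ (All.universal (λ j → All.map⁺ (All.universal (gV≢hV j i) (allFin m))) (neighbours G i)))

    #nbrs : length nbrs ≡ degree G i + m
    #nbrs = begin
      length nbrs                                                     ≡⟨ length-++ (map gV (neighbours G i)) ⟩
      length (map gV (neighbours G i)) + length (map (hV i) (allFin m)) ≡⟨ cong₂ _+_ (length-map gV (neighbours G i)) (length-map (hV i) (allFin m)) ⟩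
      length (neighbours G i) + length (allFin m)                     ≡⟨ cong₂ _+_ (sym (degree≡#neighbours G i)) (length-tabulate (λ a → a)) ⟩
      degree G i + m                                                  ∎
      where open ≡-Reasoning

  hV-bound : Fin n → ∀ a → degree H a + 1 ≤ d
  hV-bound i a = subst (_≤ d) #nbrs (#neighbours≤#labels (hV i a) nbrs nbrs-adjacent nbrs-distinct)
    where
    nbrs : List (Fin (n + n * m))
    nbrs = gV i ∷ map (hV i) (neighbours H a)

    nbrs-adjacent : All (λ y → Adj GH (hV i a) y ≡ true) nbrs
    nbrs-adjacent = spoke′ i a ∷ All.map⁺ (All.map (hh-edge-within i) (neighbours-adjacent H a))

    nbrs-distinct : AllPairs _≢_ nbrs
    nbrs-distinct = All.map⁺ (All.universal (gV≢hV i i) (neighbours H a))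
                  ∷ map-distinct (proj₂ ∘ hV-injective) (neighbours-distinct H a)

    #nbrs : length nbrs ≡ degree H a + 1
    #nbrs = begin
      suc (length (map (hV i) (neighbours H a))) ≡⟨ cong suc (length-map (hV i) (neighbours H a)) ⟩
      suc (length (neighbours H a))              ≡⟨ cong suc (degree≡#neighbours H a) ⟨
      suc (degree H a)                           ≡⟨ +-comm 1 (degree H a) ⟩
      degree H a + 1                             ∎
      where open ≡-Reasoning

  ΔG+m≤d : Fin n → Δ G + m ≤ d
  ΔG+m≤d = Δ+k-bound G gV-bound

  ΔH+1≤d : Fin n → Fin m → Δ H + 1 ≤ d
  ΔH+1≤d i = Δ+k-bound H (hV-bound i)

module UpperBound {n m dG dH : ℕ} (G : Graph n) (H : Graph m)
                  (cG : EdgeLabeling n dG) (cG-proper : IsProperEdgeLabeling G cG)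
                  (cG-distinguishing : IsDistinguishing G cG)
                  (cH : EdgeLabeling m dH) (cH-proper : IsProperEdgeLabeling H cH)
                  (a₀ a₁ : Fin m) (a₀≢a₁ : a₀ ≢ a₁) where
  open Corona G H
  module PG = IsProperEdgeLabeling cG-proper
  module PH = IsProperEdgeLabeling cH-proper

  D : ℕ
  D = dG ⊔ dH

  fromG : Fin dG → Fin (D + m)
  fromG x = inject≤ x (m≤m⊔n dG dH) ↑ˡ m

  fromH : Fin dH → Fin (D + m)
  fromH x = inject≤ x (m≤n⊔m dG dH) ↑ˡ m

  new : Fin m → Fin (D + m)
  new a = D ↑ʳ a

  fromG-injective : ∀ {x y} → fromG x ≡ fromG y → x ≡ y
  fromG-injective = inject≤-injective _ _ _ _ ∘ ↑ˡ-injective m _ _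

  fromH-injective : ∀ {x y} → fromH x ≡ fromH y → x ≡ y
  fromH-injective = inject≤-injective _ _ _ _ ∘ ↑ˡ-injective m _ _

  new-injective : ∀ {a b} → new a ≡ new b → a ≡ b
  new-injective = ↑ʳ-injective D _ _

  old≢new : ∀ (x : Fin D) a → x ↑ˡ m ≢ new a
  old≢new x a e with trans (sym (splitAt-↑ˡ D x m)) (trans (cong (splitAt D) e) (splitAt-↑ʳ D m a))
  ... | ()

  label : EdgeLabeling (n + n * m) (D + m)
  label x y with splitAt n x | splitAt n y
  ... | inj₁ i | inj₁ j = fromG (cG i j)
  ... | inj₁ _ | inj₂ q = new (pos {n} m q)
  ... | inj₂ p | inj₁ _ = new (pos {n} m p)
  ... | inj₂ p | inj₂ q = fromH (cH (pos {n} m p) (pos {n} m q))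

  label-gg : ∀ i j → label (gV i) (gV j) ≡ fromG (cG i j)
  label-gg i j rewrite split-gV i | split-gV j = refl

  label-gh : ∀ i j a → label (gV i) (hV j a) ≡ new a
  label-gh i j a rewrite split-gV i | split-hV j a | pos-hV j a = refl

  label-hg : ∀ i a j → label (hV i a) (gV j) ≡ new a
  label-hg i a j rewrite split-hV i a | split-gV j | pos-hV i a = refl

  label-hh : ∀ i a j b → label (hV i a) (hV j b) ≡ fromH (cH a b)
  label-hh i a j b rewrite split-hV i a | split-hV j b | pos-hV i a | pos-hV j b = refl

  label-symmetric : ∀ u v → Adj GH u v ≡ true → label u v ≡ label v u
  label-symmetric u v uv with view u | view v
  ... | inG i | inG j =
    trans (label-gg i j) (trans (cong fromG (PG.symmetric i j (trans (sym (adj-gg i j)) uv))) (sym (label-gg j i)))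
  ... | inG i | inH j b = trans (label-gh i j b) (sym (label-hg j b i))
  ... | inH i a | inG j = trans (label-hg i a j) (sym (label-gh j i a))
  ... | inH i a | inH j b =
    trans (label-hh i a j b) (trans (cong fromH (PH.symmetric a b (proj₂ (hh-edge uv)))) (sym (label-hh j b i a)))

  proper-at-gV : ∀ i v w → Adj GH (gV i) v ≡ true → Adj GH (gV i) w ≡ true → v ≢ w →
    label (gV i) v ≢ label (gV i) w
  proper-at-gV i v w iv iw v≢w e with view v | view w
  ... | inG j | inG k =
    PG.proper i j k (trans (sym (adj-gg i j)) iv) (trans (sym (adj-gg i k)) iw) (v≢w ∘ cong gV)
      (fromG-injective (trans (sym (label-gg i j)) (trans e (label-gg i k))))
  ... | inG j | inH k b = old≢new _ b (trans (sym (label-gg i j)) (trans e (label-gh i k b)))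
  ... | inH j a | inG k = old≢new _ a (sym (trans (sym (label-gh i j a)) (trans e (label-gg i k))))
  ... | inH j a | inH k b =
    v≢w (cong₂ hV (trans (sym (spoke-same iv)) (spoke-same iw))
                  (new-injective (trans (sym (label-gh i j a)) (trans e (label-gh i k b)))))

  proper-at-hV : ∀ i a v w → Adj GH (hV i a) v ≡ true → Adj GH (hV i a) w ≡ true → v ≢ w →
    label (hV i a) v ≢ label (hV i a) w
  proper-at-hV i a v w av aw v≢w e with view v | view w
  ... | inG j | inG k = v≢w (cong gV (trans (sym (spoke′-same av)) (spoke′-same aw)))
  ... | inG j | inH k b = old≢new _ a (sym (trans (sym (label-hg i a j)) (trans e (label-hh i a k b))))
  ... | inH j b | inG k = old≢new _ a (trans (sym (label-hh i a j b)) (trans e (label-hg i a k)))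
  ... | inH j b | inH k b′ with hh-edge av | hh-edge aw
  ...   | i≡j , ab | i≡k , ab′ =
    PH.proper a b b′ ab ab′ (v≢w ∘ cong₂ hV (trans (sym i≡j) i≡k))
      (fromH-injective (trans (sym (label-hh i a j b)) (trans e (label-hh i a k b′))))

  label-proper : IsProperEdgeLabeling GH label
  label-proper = record { symmetric = label-symmetric ; proper = proper }
    where
    proper : ∀ u v w → Adj GH u v ≡ true → Adj GH u w ≡ true → v ≢ w → label u v ≢ label u w
    proper u v w with view u
    ... | inG i = proper-at-gV i v w
    ... | inH i a = proper-at-hV i a v w

  new-label-at-hV : ∀ j b y a → Adj GH (hV j b) y ≡ true → label (hV j b) y ≡ new a → a ≡ b
  new-label-at-hV j b y a _ e with view y
  ... | inG k = sym (new-injective (trans (sym (label-hg j b k)) e))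
  ... | inH k c = ⊥-elim (old≢new _ a (trans (sym (label-hh j b k c)) e))

  new-label-at-gV : ∀ i a y → Adj GH y (gV i) ≡ true → label y (gV i) ≡ new a → y ≡ hV i a
  new-label-at-gV i a y yi e with view y
  ... | inG k = ⊥-elim (old≢new _ a (trans (sym (label-gg k i)) e))
  ... | inH j b = cong₂ hV (spoke′-same yi) (new-injective (trans (sym (label-hg j b i)) e))

  two-new-labels⇒gV : ∀ x y₀ y₁ → Adj GH x y₀ ≡ true → Adj GH x y₁ ≡ true →
    label x y₀ ≡ new a₀ → label x y₁ ≡ new a₁ → Σ (Fin n) λ j → x ≡ gV j
  two-new-labels⇒gV x y₀ y₁ xy₀ xy₁ e₀ e₁ with view x
  ... | inG j = j , refl
  ... | inH j b = ⊥-elim (a₀≢a₁ (trans (new-label-at-hV j b y₀ a₀ xy₀ e₀) (sym (new-label-at-hV j b y₁ a₁ xy₁ e₁))))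

  maps-G-to-G : (f : Automorphism GH) → Preserves f label → ∀ i → Σ (Fin n) λ j → to f (gV i) ≡ gV j
  maps-G-to-G f f-pres i =
    two-new-labels⇒gV (to f (gV i)) (to f (hV i a₀)) (to f (hV i a₁))
      (trans (preserve f _ _) (spoke i a₀)) (trans (preserve f _ _) (spoke i a₁))
      (trans (f-pres _ _ (spoke i a₀)) (label-gh i i a₀)) (trans (f-pres _ _ (spoke i a₁)) (label-gh i i a₁))

  module _ (f : Automorphism GH) (f-pres : Preserves f label) where
    private
      f⁻¹-pres : Preserves (inverse f) label
      f⁻¹-pres = inverse-preserves f f-pres

    onG : Fin n → Fin n
    onG i = proj₁ (maps-G-to-G f f-pres i)

    onG⁻¹ : Fin n → Fin n
    onG⁻¹ i = proj₁ (maps-G-to-G (inverse f) f⁻¹-pres i)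

    onG-spec : ∀ i → to f (gV i) ≡ gV (onG i)
    onG-spec i = proj₂ (maps-G-to-G f f-pres i)

    onG⁻¹-spec : ∀ i → from f (gV i) ≡ gV (onG⁻¹ i)
    onG⁻¹-spec i = proj₂ (maps-G-to-G (inverse f) f⁻¹-pres i)

    restriction : Automorphism G
    restriction = record
      { to = onG ; from = onG⁻¹
      ; to-from = λ i → gV-injective (begin
          gV (onG (onG⁻¹ i))   ≡⟨ onG-spec (onG⁻¹ i) ⟨
          to f (gV (onG⁻¹ i))  ≡⟨ cong (to f) (onG⁻¹-spec i) ⟨
          to f (from f (gV i)) ≡⟨ to-from f (gV i) ⟩
          gV i                 ∎)
      ; from-to = λ i → gV-injective (begin
          gV (onG⁻¹ (onG i))   ≡⟨ onG⁻¹-spec (onG i) ⟨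
          from f (gV (onG i))  ≡⟨ cong (from f) (onG-spec i) ⟨
          from f (to f (gV i)) ≡⟨ from-to f (gV i) ⟩
          gV i                 ∎)
      ; preserve = λ i j → begin
          Adj G (onG i) (onG j)               ≡⟨ adj-gg (onG i) (onG j) ⟨
          Adj GH (gV (onG i)) (gV (onG j))    ≡⟨ cong₂ (Adj GH) (onG-spec i) (onG-spec j) ⟨
          Adj GH (to f (gV i)) (to f (gV j))  ≡⟨ preserve f (gV i) (gV j) ⟩
          Adj GH (gV i) (gV j)                ≡⟨ adj-gg i j ⟩
          Adj G i j                           ∎
      }
      where open ≡-Reasoning

    restriction-preserves : Preserves restriction cG
    restriction-preserves i j ij = fromG-injective (begin
      fromG (cG (onG i) (onG j))          ≡⟨ label-gg (onG i) (onG j) ⟨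
      label (gV (onG i)) (gV (onG j))     ≡⟨ cong₂ label (onG-spec i) (onG-spec j) ⟨
      label (to f (gV i)) (to f (gV j))   ≡⟨ f-pres (gV i) (gV j) (trans (adj-gg i j) ij) ⟩
      label (gV i) (gV j)                 ≡⟨ label-gg i j ⟩
      fromG (cG i j)                      ∎)
      where open ≡-Reasoning

    fixes-gV : ∀ i → to f (gV i) ≡ gV i
    fixes-gV i = trans (onG-spec i) (cong gV (cG-distinguishing restriction restriction-preserves i))

    fixes-hV : ∀ i a → to f (hV i a) ≡ hV i a
    fixes-hV i a = new-label-at-gV i a (to f (hV i a))
      (subst (λ z → Adj GH (to f (hV i a)) z ≡ true) (fixes-gV i) (trans (preserve f _ _) (spoke′ i a)))
      (subst (λ z → label (to f (hV i a)) z ≡ new a) (fixes-gV i)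
        (trans (f-pres _ _ (spoke′ i a)) (label-hg i a i)))

  label-distinguishing : IsDistinguishing GH label
  label-distinguishing f f-pres x with view x
  ... | inG i = fixes-gV f f-pres i
  ... | inH i a = fixes-hV f f-pres i a

  hasLabeling : HasDistProperLabeling GH (D + m)
  hasLabeling = label , label-proper , label-distinguishing

-- The theorem.
mainTheorem5 : ∀ {n m} (G : Graph n) (H : Graph m) →
    3 ≤ n → 3 ≤ m → Connected G → Connected H →
    ∀ dG dH dGH →
    IsDistChromaticIndex G dG →
    IsDistChromaticIndex H dH →
    IsDistChromaticIndex (corona G H) dGH →
    ((Δ G + m) ⊔ (Δ H + 1) ≤ dGH) × (dGH ≤ (dG ⊔ dH) + m)
mainTheorem5 {suc n} {suc (suc m)} G H (s≤s _) (s≤s (s≤s _)) _ _ dG dH dGH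
  ((cG , cG-proper , cG-distinguishing) , _) ((cH , cH-proper , _) , _) ((c , c-proper , _) , dGH-least) =
  ⊔-lub (ΔG+m≤d fzero) (ΔH+1≤d fzero fzero) , dGH-least (dG ⊔ dH + suc (suc m)) hasLabeling
  where
  open LowerBound G H c c-proper
  open UpperBound G H cG cG-proper cG-distinguishing cH cH-proper fzero (fsuc fzero) (λ ())
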